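{- Let $\mathcal{G}$ be a hereditary class of graphs and $p\ge 0$ a fixed integer. If $\mathcal{G}$ has a finite set of forbidden induced subgraphs, then so does its $p$-edge-add class.
   Context: All graphs are simple, finite and undirected. A class of graphs is hereditary if it is closed under taking induced subgraphs; a forbidden induced subgraph for it is a graph not in the class all of whose proper induced subgraphs are in the class. A non-edge of $G$ is an edge of its complement. The $p$-edge-add class of $\mathcal{G}$ is the class of graphs $G$ such that a graph in $\mathcal{G}$ can be obtained from $G$ by adding at most $p$ non-edges of $G$. -}

module Defs where

open import Data.Nat using (ℕ; _≤_; _<_)
open import Data.Fin using (Fin)
open import Data.Bool using (Bool; true; false)
open import Data.List using (List; length)
open import Data.List.Relation.Unary.Any using (Any)
open import Data.List.Membership.Propositional using (_∈_)
open import Data.Product using (Σ; _×_; _,_)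
open import Data.Sum using (_⊎_)
open import Relation.Binary.PropositionalEquality using (_≡_)
open import Relation.Nullary using (¬_)
open import Function.Definitions using (Injective)

record AdjOn (n : ℕ) : Set where
  field
    adj    : Fin n → Fin n → Bool
    sym    : ∀ u v → adj u v ≡ adj v u
    irrefl : ∀ v → adj v v ≡ false
open AdjOn public

record Graph : Set where
  constructor ⟨_,_⟩
  field
    size      : ℕ
    structure : AdjOn size
open Graph public

Adj : (G : Graph) → Fin (size G) → Fin (size G) → Bool
Adj G = adj (structure G)

_⊑_ : Graph → Graph → Set
H ⊑ G = Σ (Fin (size H) → Fin (size G)) λ f →
          Injective _≡_ _≡_ f × (∀ u v → Adj G (f u) (f v) ≡ Adj H u v)

_≅_ : Graph → Graph → Set
G ≅ H = Σ (Fin (size G) → Fin (size H)) λ f →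
        Σ (Fin (size H) → Fin (size G)) λ g →
          (∀ x → g (f x) ≡ x) × (∀ y → f (g y) ≡ y) ×
          (∀ u v → Adj H (f u) (f v) ≡ Adj G u v)

GraphClass : Set₁
GraphClass = Graph → Set

Hereditary : GraphClass → Set
Hereditary 𝒢 = ∀ G H → H ⊑ G → 𝒢 G → 𝒢 H

Forbidden : GraphClass → Graph → Set
Forbidden 𝒢 F = ¬ 𝒢 F × (∀ H → H ⊑ F → size H < size F → 𝒢 H)

HasFiniteForbidden : GraphClass → Set
HasFiniteForbidden 𝒢 =
  Σ (List Graph) λ L → ∀ F → Forbidden 𝒢 F → Any (λ H → F ≅ H) L

-- The p-edge-add class of 𝒢: G such that adding at most p non-edges of G
-- yields a graph in 𝒢.
EdgeAdd : ℕ → GraphClass → GraphClass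
EdgeAdd p 𝒢 G =
  Σ (AdjOn (size G)) λ A →
    𝒢 ⟨ size G , A ⟩ ×
    (∀ u v → Adj G u v ≡ true → adj A u v ≡ true) ×
    Σ (List (Fin (size G) × Fin (size G))) λ es →
      length es ≤ p ×
      (∀ u v → adj A u v ≡ true → Adj G u v ≡ false →
         ((u , v) ∈ es) ⊎ ((v , u) ∈ es))

-- A vertex list S of G is a bad set for a class 𝒞 when G [ S ] ∉ 𝒞.  For a
-- hereditary class, having finitely many forbidden induced subgraphs amounts to
-- their sizes being bounded, and that amounts to every graph outside the class
-- having a bad set of bounded size.  If every G ∉ 𝒢 has a bad set of at most k
-- vertices, then by induction on p every G outside the p-edge-add class has one
-- of at most bound k p vertices: take a bad set S for 𝒢 and, for every pair a, b,
-- a bad set T a b of G + ab for the (p - 1)-edge-add class.  With U = S ∪ ⋃ T a b,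
-- a completion of G [ U ] in 𝒢 with at most p new edges either adds no edge inside
-- S, and then contains G [ S ], or adds some edge ab inside S, and then completes
-- (G + ab) [ U ], hence also (G + ab) [ T a b ], with at most p - 1 new edges.
-- Membership in 𝒢 is not decidable, so the argument runs in the double negation
-- monad; it is escaped at the end because a size bound is decidable.
module Submission where

open import Data.Bool using (Bool; true; false; _∧_; _∨_; not)
open import Data.Bool.Properties using (∧-comm; ∧-idem; ⇔→≡) renaming (_≟_ to _≟ᴮ_)
open import Data.Fin using (Fin; zero; suc)
open import Data.Fin.Properties using (_≟_; all?; any?; ¬∀⟶∃¬; injective⇒≤; ∀-cons)
open import Data.List
  using (List; []; _∷_; _++_; length; map; concatMap; tabulate; allFin; filter; lookup; deduplicate;
         mapMaybe; cartesianProductWith; upTo)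
open import Data.List.Membership.Propositional using (_∈_)
open import Data.List.Membership.Propositional.Properties
  using (∈-lookup; ∈-deduplicate⁺; ∈-deduplicate⁻; ∈-filter⁺; ∈-allFin; ∈-tabulate⁺; ∈-++⁺ˡ; ∈-++⁺ʳ;
         ∈-concatMap⁺; ∈-cartesianProductWith⁺)
open import Data.List.Properties using (length-deduplicate; filter-notAll; length-tabulate; length-mapMaybe; length-++)
open import Data.List.Relation.Binary.Subset.Propositional using (_⊆_)
import Data.List.Relation.Unary.All as All
open import Data.List.Relation.Unary.AllPairs using (_∷_)
open import Data.List.Relation.Unary.Any using (Any; here; there; index)
import Data.List.Relation.Unary.Any as Any
import Data.List.Relation.Unary.Any.Properties as Any
open import Data.List.Relation.Unary.Unique.Propositional using (Unique)
import Data.List.Relation.Unary.Unique.DecPropositional.Properties as Unique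
open import Data.Maybe using (Maybe; just; nothing; zip)
import Data.Maybe.Relation.Unary.Any as MaybeAny
open import Data.Nat using (ℕ; zero; suc; _+_; _*_; _≤_; _<_; _≤?_; s≤s; z≤n)
open import Data.Nat.Induction using (<-wellFounded)
open import Data.Nat.Properties
  using (≤-refl; ≤-reflexive; ≤-trans; ≤-<-trans; <-≤-trans; ≤-pred; ≰⇒>; <⇒≱; +-mono-≤; *-mono-≤; ≤-totalOrder)
open import Data.List.Extrema ≤-totalOrder using (max; v≤max⁺)
open import Data.Product using (Σ; ∃; ∃₂; _×_; _,_; proj₁; proj₂)
import Data.Product as Product
open import Data.Sum using (_⊎_; inj₁; inj₂)
import Data.Sum as Sum
open import Data.Vec using (Vec; []; _∷_)
import Data.Vec as Vec
open import Data.Vec.Properties using (lookup∘tabulate)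
open import Effect.Monad using (RawMonad)
open import Function using (_∘_; id; _⇔_; mk⇔)
open import Function.Definitions using (Injective)
import Induction.WellFounded as WF
open import Level using (0ℓ)
import Relation.Binary.Construct.On as On
open import Relation.Binary.PropositionalEquality using (_≡_; _≢_; refl; sym; trans; cong; cong₂)
open import Relation.Nullary using (¬_; Dec; yes; no; ¬?; does; contradiction)
open import Relation.Nullary.Decidable
  using (_×-dec_; _⊎-dec_; dec-true; dec-false; does-⇔; decidable-stable; ¬¬-excluded-middle)
open import Relation.Nullary.Negation using (¬¬-Monad; ¬¬-map)

open import Defs hiding (sym)

open RawMonad (¬¬-Monad {0ℓ}) using (pure; _>>=_)

¬¬-pull : ∀ {n} {P : Fin n → Set} → (∀ i → ¬ ¬ P i) → ¬ ¬ (∀ i → P i)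
¬¬-pull {zero}  _ = pure λ ()
¬¬-pull {suc n} h = do
  p₀ ← h zero
  ps ← ¬¬-pull (h ∘ suc)
  pure (∀-cons p₀ ps)

pullback : ∀ {m n} → AdjOn n → (Fin m → Fin n) → AdjOn m
pullback A h = record
  { adj    = λ u v → adj A (h u) (h v)
  ; sym    = λ u v → AdjOn.sym A (h u) (h v)
  ; irrefl = λ v → irrefl A (h v)
  }

infixl 30 _∘ᴳ_
_∘ᴳ_ : ∀ {m} (G : Graph) → (Fin m → Fin (size G)) → Graph
G ∘ᴳ h = ⟨ _ , pullback (structure G) h ⟩

∘ᴳ-⊑ : ∀ {m} {G : Graph} {h : Fin m → Fin (size G)} → Injective _≡_ _≡_ h → G ∘ᴳ h ⊑ G
∘ᴳ-⊑ {h = h} h-inj = h , h-inj , λ _ _ → refl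

⊑-refl : ∀ {G} → G ⊑ G
⊑-refl = id , id , λ _ _ → refl

⊑-trans : ∀ {H K G} → H ⊑ K → K ⊑ G → H ⊑ G
⊑-trans (f , f-inj , f-adj) (g , g-inj , g-adj) =
  g ∘ f , f-inj ∘ g-inj , λ u v → trans (g-adj (f u) (f v)) (f-adj u v)

≅⇒size≤ : ∀ {G H} → G ≅ H → size G ≤ size H
≅⇒size≤ (f , g , g∘f , _) = injective⇒≤ λ {x} {y} eq → trans (sym (g∘f x)) (trans (cong g eq) (g∘f y))

lookup-injective : ∀ {n} {xs : List (Fin n)} → Unique xs → Injective _≡_ _≡_ (lookup xs)
lookup-injective {xs = _ ∷ _} _         {zero}  {zero}  _  = refl
lookup-injective {xs = _ ∷ _} (x≢ ∷ _)  {zero}  {suc j} eq = contradiction eq (All.lookup x≢ (∈-lookup j))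
lookup-injective {xs = _ ∷ _} (x≢ ∷ _)  {suc i} {zero}  eq = contradiction (sym eq) (All.lookup x≢ (∈-lookup i))
lookup-injective {xs = _ ∷ _} (_ ∷ xs!) {suc i} {suc j} eq = cong suc (lookup-injective xs! eq)

-- Vertex sets are lists; G [ S ] is induced on the distinct entries of S.
module _ {n : ℕ} (S : List (Fin n)) where

  card : ℕ
  card = length (deduplicate _≟_ S)

  enum : Fin card → Fin n
  enum = lookup (deduplicate _≟_ S)

  card≤length : card ≤ length S
  card≤length = length-deduplicate _≟_ S

  enum-injective : Injective _≡_ _≡_ enum
  enum-injective = lookup-injective (Unique.deduplicate-! _≟_ S)

  enum-∈ : ∀ i → enum i ∈ S
  enum-∈ i = ∈-deduplicate⁻ _≟_ S (∈-lookup i)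

  position : ∀ {v} → v ∈ S → Fin card
  position v∈S = index (∈-deduplicate⁺ _≟_ v∈S)

  enum-position : ∀ {v} (v∈S : v ∈ S) → enum (position v∈S) ≡ v
  enum-position v∈S = sym (Any.lookup-index (∈-deduplicate⁺ _≟_ v∈S))

infixl 30 _[_]
_[_] : (G : Graph) → List (Fin (size G)) → Graph
G [ S ] = G ∘ᴳ enum S

[]-⊑ : ∀ G S → G [ S ] ⊑ G
[]-⊑ G S = ∘ᴳ-⊑ {G = G} (enum-injective S)

⊑-[] : ∀ {H} G {S} (e : H ⊑ G) → (∀ i → proj₁ e i ∈ S) → H ⊑ G [ S ]
⊑-[] {H} G {S} (f , f-inj , f-adj) f∈S = position S ∘ f∈S , injective , adjacent
  where
    enum-f : ∀ i → enum S (position S (f∈S i)) ≡ f i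
    enum-f i = enum-position S (f∈S i)
    injective : Injective _≡_ _≡_ (position S ∘ f∈S)
    injective {i} {j} eq = f-inj (trans (sym (enum-f i)) (trans (cong (enum S) eq) (enum-f j)))
    adjacent : ∀ u v → Adj G (enum S (position S (f∈S u))) (enum S (position S (f∈S v))) ≡ Adj H u v
    adjacent u v = trans (cong₂ (Adj G) (enum-f u) (enum-f v)) (f-adj u v)

⊆-[] : ∀ G {S T} → S ⊆ T → G [ S ] ⊑ G [ T ]
⊆-[] G {S} S⊆T = ⊑-[] {G [ S ]} G ([]-⊑ G S) (S⊆T ∘ enum-∈ S)

<⇒misses : ∀ {m n} (f : Fin m → Fin n) → m < n → ∃ λ v → ∀ i → f i ≢ v
<⇒misses {m} {n} f m<n =
  Product.map₂ (λ ∄i i eq → ∄i (i , eq)) (¬∀⟶∃¬ n _ (λ v → any? λ i → f i ≟ v) not-surjective)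
  where
    not-surjective : ¬ (∀ v → ∃ λ i → f i ≡ v)
    not-surjective surj = <⇒≱ m<n (injective⇒≤ λ {v} {w} eq →
      trans (sym (proj₂ (surj v))) (trans (cong f eq) (proj₂ (surj w))))

allBut : ∀ {n} → Fin n → List (Fin n)
allBut v = filter (λ u → ¬? (u ≟ v)) (allFin _)

infixl 30 _-_
_-_ : (G : Graph) → Fin (size G) → Graph
G - v = G [ allBut v ]

deletion-shrinks : ∀ {G} v → size (G - v) < size G
deletion-shrinks {G} v =
  ≤-<-trans (card≤length (allBut v))
            (<-≤-trans (filter-notAll _ (allFin _) v∈) (≤-reflexive (length-tabulate id)))
  where
    v∈ : Any (λ u → ¬ u ≢ v) (allFin (size G))
    v∈ = Any.map (λ { refl u≢u → u≢u refl }) (∈-allFin v)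

⊑-avoiding : ∀ {H G v} (e : H ⊑ G) → (∀ i → proj₁ e i ≢ v) → H ⊑ G - v
⊑-avoiding {H} {G} {v} e avoids =
  ⊑-[] {H} G e λ i → ∈-filter⁺ (λ u → ¬? (u ≟ v)) (∈-allFin (proj₁ e i)) (avoids i)

ContainsForbidden : GraphClass → Graph → Set
ContainsForbidden 𝒢 G = Σ Graph λ H → H ⊑ G × Forbidden 𝒢 H

-- If every G - v lies in 𝒢 then G is forbidden; otherwise recurse into some G - v ∉ 𝒢.
contains-forbidden : ∀ {𝒢} → Hereditary 𝒢 → ∀ G → ¬ 𝒢 G → ¬ ¬ ContainsForbidden 𝒢 G
contains-forbidden {𝒢} her = WF.All.wfRec (On.wellFounded size <-wellFounded) 0ℓ _ step
  where
    step : ∀ G → (∀ {H} → size H < size G → ¬ 𝒢 H → ¬ ¬ ContainsForbidden 𝒢 H) →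
           ¬ 𝒢 G → ¬ ¬ ContainsForbidden 𝒢 G
    step G recurse G∉ = do
      decided ← ¬¬-pull λ v → ¬¬-excluded-middle
      descend decided (all? decided)
      where
        descend : (∀ v → Dec (𝒢 (G - v))) → Dec (∀ v → 𝒢 (G - v)) → ¬ ¬ ContainsForbidden 𝒢 G
        descend _ (yes deletions∈) = pure (G , ⊑-refl {G} , G∉ , proper∈)
          where
            proper∈ : ∀ H → H ⊑ G → size H < size G → 𝒢 H
            proper∈ H e H<G =
              let v , avoids = <⇒misses (proj₁ e) H<G in her (G - v) H (⊑-avoiding {H} {G} e avoids) (deletions∈ v)
        descend decided (no ¬deletions∈) =
          let v , G-v∉ = ¬∀⟶∃¬ _ _ decided ¬deletions∈ in
          ¬¬-map (λ (H , e , H-forbidden) → H , ⊑-trans {H} {G - v} {G} e ([]-⊑ G (allBut v)) , H-forbidden)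
                 (recurse {G - v} (deletion-shrinks {G} v) G-v∉)

BadSet : GraphClass → ℕ → Graph → Set
BadSet 𝒞 m G = Σ (List (Fin (size G))) λ S → length S ≤ m × ¬ 𝒞 (G [ S ])

bad-set⇒forbidden-size≤ : ∀ {𝒞 m} → (∀ G → ¬ 𝒞 G → ¬ ¬ BadSet 𝒞 m G) → ∀ F → Forbidden 𝒞 F → size F ≤ m
bad-set⇒forbidden-size≤ {m = m} bad-set F (F∉ , proper∈) = decidable-stable (size F ≤? m) λ F≰m →
  bad-set F F∉ λ (S , |S|≤m , S∉) →
    S∉ (proper∈ (F [ S ]) ([]-⊑ F S) (≤-<-trans (card≤length S) (≤-<-trans |S|≤m (≰⇒> F≰m))))

forbidden-size≤⇒bad-set : ∀ {𝒞 m} → Hereditary 𝒞 → (∀ F → Forbidden 𝒞 F → size F ≤ m) →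
                          ∀ G → ¬ 𝒞 G → ¬ ¬ BadSet 𝒞 m G
forbidden-size≤⇒bad-set {𝒞} {m} her bounded G G∉ = ¬¬-map image-bad (contains-forbidden her G G∉)
  where
    image-bad : ContainsForbidden 𝒞 G → BadSet 𝒞 m G
    image-bad (H , e , H-forbidden) =
      tabulate (proj₁ e) ,
      ≤-trans (≤-reflexive (length-tabulate _)) (bounded H H-forbidden) ,
      λ S∈ → proj₁ H-forbidden (her (G [ tabulate (proj₁ e) ]) H (⊑-[] {H} G e ∈-tabulate⁺) S∈)

_⊆ᴱ_ : ∀ {n} → AdjOn n → AdjOn n → Set
A ⊆ᴱ B = ∀ u v → adj A u v ≡ true → adj B u v ≡ true

infix 4 _≈ᵉ_ _≈ᵉ?_
_≈ᵉ_ : ∀ {n} → Fin n × Fin n → Fin n × Fin n → Set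
(u , v) ≈ᵉ (a , b) = (u ≡ a × v ≡ b) ⊎ (u ≡ b × v ≡ a)

_≈ᵉ?_ : ∀ {n} (e f : Fin n × Fin n) → Dec (e ≈ᵉ f)
(u , v) ≈ᵉ? (a , b) = (u ≟ a ×-dec v ≟ b) ⊎-dec (u ≟ b ×-dec v ≟ a)

≈ᵉ-swap : ∀ {n} {u v : Fin n} {e} → (v , u) ≈ᵉ e → (u , v) ≈ᵉ e
≈ᵉ-swap = Sum.[ inj₂ ∘ Product.swap , inj₁ ∘ Product.swap ]

-- The condition u ≢ v makes addEdge G a a = G, so addEdge needs no hypothesis a ≢ b.
Joins : ∀ {n} → Fin n → Fin n → Fin n → Fin n → Set
Joins a b u v = u ≢ v × (u , v) ≈ᵉ (a , b)

-- Opaque, so that a with-abstraction over joins? is not undone by unfolding it.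
opaque
  joins? : ∀ {n} (a b u v : Fin n) → Dec (Joins a b u v)
  joins? a b u v = ¬? (u ≟ v) ×-dec (u , v) ≈ᵉ? (a , b)

Joins-sym : ∀ {n} {a b u v : Fin n} → Joins a b u v → Joins a b v u
Joins-sym (u≢v , uv≈ab) = u≢v ∘ sym , ≈ᵉ-swap uv≈ab

Joins-injective : ∀ {m n} {h : Fin m → Fin n} → Injective _≡_ _≡_ h →
                  ∀ {a b u v} → Joins a b u v ⇔ Joins (h a) (h b) (h u) (h v)
Joins-injective {h = h} h-inj = mk⇔
  (Product.map (_∘ h-inj) (Sum.map (Product.map (cong h) (cong h)) (Product.map (cong h) (cong h))))
  (Product.map (_∘ cong h) (Sum.map (Product.map h-inj h-inj) (Product.map h-inj h-inj)))

addEdge : (G : Graph) → Fin (size G) → Fin (size G) → Graph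
addEdge G a b = ⟨ size G , record
  { adj    = λ u v → Adj G u v ∨ does (joins? a b u v)
  ; sym    = λ u v → cong₂ _∨_ (AdjOn.sym (structure G) u v)
                               (does-⇔ (mk⇔ Joins-sym Joins-sym) (joins? a b u v) (joins? a b v u))
  ; irrefl = λ v → cong₂ _∨_ (irrefl (structure G) v) (dec-false (joins? a b v v) λ (v≢v , _) → v≢v refl)
  } ⟩

addEdge-⊇ : ∀ G {a b} → structure G ⊆ᴱ structure (addEdge G a b)
addEdge-⊇ G {a} {b} u v uv∈G = cong (_∨ does (joins? a b u v)) uv∈G

addEdge-edge⁻ : ∀ G {a b u v} → Adj (addEdge G a b) u v ≡ true → Adj G u v ≡ true ⊎ Joins a b u v
addEdge-edge⁻ G {a} {b} {u} {v} uv∈ with Adj G u v | joins? a b u v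
... | true  | _     = inj₁ refl
... | false | yes j = inj₂ j
... | false | no _  = contradiction uv∈ λ ()

addEdge-non-edge⁻ : ∀ G {a b u v} → Adj (addEdge G a b) u v ≡ false → Adj G u v ≡ false × ¬ Joins a b u v
addEdge-non-edge⁻ G {a} {b} {u} {v} uv∉ with Adj G u v | joins? a b u v
... | false | no ¬j = refl , ¬j
... | false | yes _ = contradiction uv∉ λ ()
... | true  | _     = contradiction uv∉ λ ()

addEdge-∘ᴳ : ∀ {m} G {h : Fin m → Fin (size G)} {i j a b} → Injective _≡_ _≡_ h → h i ≡ a → h j ≡ b →
             addEdge G a b ∘ᴳ h ⊑ addEdge (G ∘ᴳ h) i j
addEdge-∘ᴳ G {h} {i} {j} h-inj refl refl = id , id , λ u v →
  cong (Adj G (h u) (h v) ∨_) (does-⇔ (Joins-injective h-inj) (joins? i j u v) (joins? (h i) (h j) (h u) (h v)))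

preimage : ∀ {m n} → (Fin m → Fin n) → Fin n → Maybe (Fin m)
preimage f v with any? (λ u → f u ≟ v)
... | yes (u , _) = just u
... | no _        = nothing

preimage-injective : ∀ {m n} {f : Fin m → Fin n} → Injective _≡_ _≡_ f → ∀ u → preimage f (f u) ≡ just u
preimage-injective {f = f} f-inj u with any? (λ u′ → f u′ ≟ f u)
... | yes (u′ , fu′≡fu) = cong just (f-inj fu′≡fu)
... | no ∄u′            = contradiction (u , refl) ∄u′

pairPreimage : ∀ {m n} → (Fin m → Fin n) → Fin n × Fin n → Maybe (Fin m × Fin m)
pairPreimage f (a , b) = zip (preimage f a) (preimage f b)

∈-pairPreimage : ∀ {m n} {f : Fin m → Fin n} → Injective _≡_ _≡_ f → ∀ {u v es} →
                 (f u , f v) ∈ es → (u , v) ∈ mapMaybe (pairPreimage f) es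
∈-pairPreimage {f = f} f-inj {u} {v} {es} fuv∈es =
  Any.mapMaybe⁺ (pairPreimage f) es (Any.map⁺ (Any.map (λ { refl → preimage-uv }) fuv∈es))
  where
    preimage-uv : MaybeAny.Any ((u , v) ≡_) (pairPreimage f (f u , f v))
    preimage-uv rewrite preimage-injective f-inj u | preimage-injective f-inj v = MaybeAny.just refl

module _ {𝒢 : GraphClass} where

  𝒢⊆EdgeAdd : ∀ {q G} → 𝒢 G → EdgeAdd q 𝒢 G
  𝒢⊆EdgeAdd {G = G} G∈𝒢 =
    structure G , G∈𝒢 , (λ _ _ → id) , [] , z≤n , λ _ _ uv∈ uv∉ → contradiction (trans (sym uv∈) uv∉) λ ()

  EdgeAdd-zero : Hereditary 𝒢 → ∀ {G} → EdgeAdd 0 𝒢 G → 𝒢 G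
  EdgeAdd-zero her {G} (A , A∈𝒢 , G⊆A , [] , _ , covered) =
    her ⟨ _ , A ⟩ G (id , id , λ u v → ⇔→≡ (mk⇔ (A⊆G u v) (G⊆A u v))) A∈𝒢
    where
      A⊆G : A ⊆ᴱ structure G
      A⊆G u v uv∈A with Adj G u v in uv∈G
      ... | true  = refl
      ... | false = contradiction (covered u v uv∈A uv∈G) λ { (inj₁ ()) ; (inj₂ ()) }

  EdgeAdd-hereditary : Hereditary 𝒢 → ∀ q → Hereditary (EdgeAdd q 𝒢)
  EdgeAdd-hereditary her q G H (f , f-inj , f-adj) (A , A∈𝒢 , G⊆A , es , |es|≤q , covered) =
    pullback A f , her ⟨ _ , A ⟩ _ (∘ᴳ-⊑ {G = ⟨ _ , A ⟩} f-inj) A∈𝒢 ,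
    (λ u v uv∈H → G⊆A (f u) (f v) (trans (f-adj u v) uv∈H)) ,
    mapMaybe (pairPreimage f) es , ≤-trans (length-mapMaybe _ es) |es|≤q ,
    λ u v uv∈A uv∉H → Sum.map (∈-pairPreimage f-inj) (∈-pairPreimage f-inj)
                                (covered (f u) (f v) uv∈A (trans (f-adj u v) uv∉H))

  EdgeAdd-addEdge⁻ : ∀ {q G a b} → EdgeAdd q 𝒢 (addEdge G a b) → EdgeAdd (suc q) 𝒢 G
  EdgeAdd-addEdge⁻ {G = G} {a} {b} (A , A∈𝒢 , G+ab⊆A , es , |es|≤q , covered) =
    A , A∈𝒢 , (λ u v → G+ab⊆A u v ∘ addEdge-⊇ G u v) , (a , b) ∷ es , s≤s |es|≤q , covered′
    where
      new-pair : ∀ {u v} → (u , v) ≈ᵉ (a , b) → (u , v) ∈ (a , b) ∷ es ⊎ (v , u) ∈ (a , b) ∷ es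
      new-pair (inj₁ (refl , refl)) = inj₁ (here refl)
      new-pair (inj₂ (refl , refl)) = inj₂ (here refl)
      covered′ : ∀ u v → adj A u v ≡ true → Adj G u v ≡ false →
                 (u , v) ∈ (a , b) ∷ es ⊎ (v , u) ∈ (a , b) ∷ es
      covered′ u v uv∈A uv∉G with Adj (addEdge G a b) u v in uv∈G+ab
      ... | false = Sum.map there there (covered u v uv∈A uv∈G+ab)
      ... | true with addEdge-edge⁻ G uv∈G+ab
      ...   | inj₁ uv∈G        = contradiction (trans (sym uv∈G) uv∉G) λ ()
      ...   | inj₂ (_ , uv≈ab) = new-pair uv≈ab

  EdgeAdd-addEdge⁺ : ∀ {q G i j} (w : EdgeAdd (suc q) 𝒢 G) →
                     adj (proj₁ w) i j ≡ true → Adj G i j ≡ false → EdgeAdd q 𝒢 (addEdge G i j)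
  EdgeAdd-addEdge⁺ {q} {G} {i} {j} (A , A∈𝒢 , G⊆A , es , |es|≤1+q , covered) ij∈A ij∉G =
    A , A∈𝒢 , G+ij⊆A , es′ , ≤-pred (≤-trans (filter-notAll _ es ij∈es) |es|≤1+q) , covered′
    where
      es′ : List (Fin (size G) × Fin (size G))
      es′ = filter (λ e → ¬? (e ≈ᵉ? (i , j))) es
      G+ij⊆A : structure (addEdge G i j) ⊆ᴱ A
      G+ij⊆A u v uv∈ with addEdge-edge⁻ G uv∈
      ... | inj₁ uv∈G                     = G⊆A u v uv∈G
      ... | inj₂ (_ , inj₁ (refl , refl)) = ij∈A
      ... | inj₂ (_ , inj₂ (refl , refl)) = trans (AdjOn.sym A j i) ij∈A
      ij∈es : Any (λ e → ¬ ¬ e ≈ᵉ (i , j)) es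
      ij∈es = Sum.[ Any.map (λ { refl ≉ → ≉ (inj₁ (refl , refl)) })
                  , Any.map (λ { refl ≉ → ≉ (inj₂ (refl , refl)) }) ] (covered i j ij∈A ij∉G)
      covered′ : ∀ u v → adj A u v ≡ true → Adj (addEdge G i j) u v ≡ false → (u , v) ∈ es′ ⊎ (v , u) ∈ es′
      covered′ u v uv∈A uv∉G+ij =
        Sum.map (λ p → ∈-filter⁺ _ p uv≉ij) (λ p → ∈-filter⁺ _ p (uv≉ij ∘ ≈ᵉ-swap)) (covered u v uv∈A uv∉G)
        where
          uv∉G : Adj G u v ≡ false
          uv∉G = proj₁ (addEdge-non-edge⁻ G uv∉G+ij)
          u≢v : u ≢ v
          u≢v refl = contradiction (trans (sym uv∈A) (irrefl A u)) λ ()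
          uv≉ij : ¬ (u , v) ≈ᵉ (i , j)
          uv≉ij = proj₂ (addEdge-non-edge⁻ G uv∉G+ij) ∘ (u≢v ,_)

agree-or-differ : ∀ {n} (f g : Fin n → Fin n → Bool) → (∀ u v → f u v ≡ g u v) ⊎ ∃₂ λ u v → f u v ≢ g u v
agree-or-differ f g with all? (λ u → all? (λ v → f u v ≟ᴮ g u v))
... | yes agree   = inj₁ agree
... | no disagree =
  let u , disagree-u = ¬∀⟶∃¬ _ _ (λ u → all? λ v → f u v ≟ᴮ g u v) disagree
      v , differ     = ¬∀⟶∃¬ _ _ (λ v → f u v ≟ᴮ g u v) disagree-u
  in inj₂ (u , v , differ)

⊑-or-new-edge : ∀ {H} G (e : H ⊑ G) (A : AdjOn (size G)) → structure G ⊆ᴱ A →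
                H ⊑ ⟨ _ , A ⟩ ⊎
                ∃₂ λ u v → adj A (proj₁ e u) (proj₁ e v) ≡ true × Adj G (proj₁ e u) (proj₁ e v) ≡ false
⊑-or-new-edge {H} G (f , f-inj , f-adj) A G⊆A =
  Sum.map (λ agree → f , f-inj , agree)
          (Product.map₂ (Product.map₂ λ differ → new-edge (differ ∘ λ eq → trans eq (f-adj _ _)) (G⊆A _ _)))
          (agree-or-differ (λ u v → adj A (f u) (f v)) (Adj H))
  where
    new-edge : ∀ {x y} → x ≢ y → (y ≡ true → x ≡ true) → x ≡ true × y ≡ false
    new-edge {true}  {false} _   _   = refl , refl
    new-edge {true}  {true}  x≢y _   = contradiction refl x≢y
    new-edge {false} {false} x≢y _   = contradiction refl x≢y
    new-edge {false} {true}  _   y⇒x = contradiction (y⇒x refl) λ ()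

length-concatMap≤ : ∀ {A B : Set} {f : A → List B} {m} → (∀ x → length (f x) ≤ m) →
                    ∀ xs → length (concatMap f xs) ≤ length xs * m
length-concatMap≤ f≤m []                 = z≤n
length-concatMap≤ {f = f} f≤m (x ∷ xs) =
  ≤-trans (≤-reflexive (length-++ (f x))) (+-mono-≤ (f≤m x) (length-concatMap≤ f≤m xs))

module _ {n : ℕ} (S : List (Fin n)) (T : Fin n → Fin n → List (Fin n)) where

  augment : List (Fin n)
  augment = S ++ concatMap (λ a → concatMap (T a) S) S

  ⊆-augment : S ⊆ augment
  ⊆-augment = ∈-++⁺ˡ

  augment-⊇ : ∀ {a b} → a ∈ S → b ∈ S → T a b ⊆ augment
  augment-⊇ a∈S b∈S v∈T =
    ∈-++⁺ʳ S (∈-concatMap⁺ _ (Any.map (λ { refl →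
      ∈-concatMap⁺ _ (Any.map (λ { refl → v∈T }) b∈S) }) a∈S))

  length-augment : ∀ {m} → (∀ a b → length (T a b) ≤ m) → length augment ≤ length S + length S * (length S * m)
  length-augment T≤m = ≤-trans (≤-reflexive (length-++ S))
    (+-mono-≤ ≤-refl (length-concatMap≤ (λ a → length-concatMap≤ (T≤m a) S) S))

-- A bad set for 𝒢 together with a bad set for each of the (at most k²) pairs inside it.
bound : ℕ → ℕ → ℕ
bound k zero    = k
bound k (suc q) = k + k * (k * bound k q)

module _ {𝒢 : GraphClass} (her : Hereditary 𝒢) where

  augment-bad : ∀ {q G} {S : List (Fin (size G))} (T : Fin (size G) → Fin (size G) → List (Fin (size G))) →
                ¬ 𝒢 (G [ S ]) → (∀ a b → ¬ EdgeAdd q 𝒢 (addEdge G a b [ T a b ])) →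
                ¬ EdgeAdd (suc q) 𝒢 (G [ augment S T ])
  augment-bad {q} {G} {S} T S∉ T∉ w@(A , A∈𝒢 , G[U]⊆A , _)
    with ⊑-or-new-edge {G [ S ]} (G [ augment S T ]) (⊆-[] G {S} (⊆-augment S T)) A G[U]⊆A
  ... | inj₁ S⊑A = S∉ (her ⟨ _ , A ⟩ (G [ S ]) S⊑A A∈𝒢)
  ... | inj₂ (u , v , uv∈A , uv∉G[U]) =
    T∉ a b (EdgeAdd-hereditary her q (addEdge (G [ U ]) i j) (addEdge G a b [ T a b ]) T⊑
                               (EdgeAdd-addEdge⁺ {𝒢} {G = G [ U ]} w uv∈A uv∉G[U]))
    where
      U : List (Fin (size G))
      U = augment S T
      a b : Fin (size G)
      a = enum S u
      b = enum S v
      a∈U : a ∈ U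
      a∈U = ⊆-augment S T (enum-∈ S u)
      b∈U : b ∈ U
      b∈U = ⊆-augment S T (enum-∈ S v)
      i j : Fin (card U)
      i = position U a∈U
      j = position U b∈U
      T⊑ : addEdge G a b [ T a b ] ⊑ addEdge (G [ U ]) i j
      T⊑ = ⊑-trans {addEdge G a b [ T a b ]} {addEdge G a b [ U ]} {addEdge (G [ U ]) i j}
             (⊆-[] (addEdge G a b) (augment-⊇ S T (enum-∈ S u) (enum-∈ S v)))
             (addEdge-∘ᴳ G (enum-injective U) (enum-position U a∈U) (enum-position U b∈U))

  EdgeAdd-bad-set : ∀ {k} → (∀ G → ¬ 𝒢 G → ¬ ¬ BadSet 𝒢 k G) →
                    ∀ q G → ¬ EdgeAdd q 𝒢 G → ¬ ¬ BadSet (EdgeAdd q 𝒢) (bound k q) G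
  EdgeAdd-bad-set bad-set zero G G∉ =
    ¬¬-map (Product.map₂ (Product.map₂ (_∘ EdgeAdd-zero her))) (bad-set G (G∉ ∘ 𝒢⊆EdgeAdd {𝒢}))
  EdgeAdd-bad-set bad-set (suc q) G G∉ = do
    S , |S|≤k , S∉ ← bad-set G (G∉ ∘ 𝒢⊆EdgeAdd {𝒢})
    T ← ¬¬-pull λ a → ¬¬-pull λ b →
          EdgeAdd-bad-set bad-set q (addEdge G a b) (G∉ ∘ EdgeAdd-addEdge⁻ {𝒢} {G = G} {a} {b})
    pure ( augment S (λ a b → proj₁ (T a b))
         , ≤-trans (length-augment S _ (λ a b → proj₁ (proj₂ (T a b))))
                   (+-mono-≤ |S|≤k (*-mono-≤ |S|≤k (*-mono-≤ |S|≤k ≤-refl)))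
         , augment-bad {G = G} {S} _ S∉ (λ a b → proj₂ (proj₂ (T a b))) )

vectors : ∀ {A : Set} → List A → ∀ n → List (Vec A n)
vectors xs zero    = [] ∷ []
vectors xs (suc n) = cartesianProductWith _∷_ xs (vectors xs n)

∈-vectors : ∀ {A : Set} {xs : List A} → (∀ x → x ∈ xs) → ∀ {n} (v : Vec A n) → v ∈ vectors xs n
∈-vectors ∈xs []      = here refl
∈-vectors ∈xs (x ∷ v) = ∈-cartesianProductWith⁺ _∷_ (∈xs x) (∈-vectors ∈xs v)

bools : List Bool
bools = true ∷ false ∷ []

∈-bools : ∀ b → b ∈ bools
∈-bools true  = here refl
∈-bools false = there (here refl)

fromMatrix : ∀ {n} → Vec (Vec Bool n) n → AdjOn n
fromMatrix {n} M = record
  { adj    = λ u v → not (does (u ≟ v)) ∧ (entry u v ∧ entry v u)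
  ; sym    = λ u v → cong₂ _∧_ (cong not (does-⇔ (mk⇔ sym sym) (u ≟ v) (v ≟ u))) (∧-comm (entry u v) _)
  ; irrefl = λ v → cong (λ b → not b ∧ (entry v v ∧ entry v v)) (dec-true (v ≟ v) refl)
  }
  where
    entry : Fin n → Fin n → Bool
    entry u v = Vec.lookup (Vec.lookup M u) v

adjacencyMatrix : (G : Graph) → Vec (Vec Bool (size G)) (size G)
adjacencyMatrix G = Vec.tabulate λ u → Vec.tabulate (Adj G u)

fromMatrix-adjacencyMatrix : ∀ G u v → adj (fromMatrix (adjacencyMatrix G)) u v ≡ Adj G u v
fromMatrix-adjacencyMatrix G u v
  rewrite lookup∘tabulate (λ u → Vec.tabulate (Adj G u)) u | lookup∘tabulate (Adj G u) v
        | lookup∘tabulate (λ u → Vec.tabulate (Adj G u)) v | lookup∘tabulate (Adj G v) u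
        | AdjOn.sym (structure G) v u | ∧-idem (Adj G u v)
  with u ≟ v
... | yes refl = sym (irrefl (structure G) u)
... | no _     = refl

graphsOfSize : ℕ → List Graph
graphsOfSize n = map (λ M → ⟨ n , fromMatrix M ⟩) (vectors (vectors bools n) n)

graphsOfSize-complete : ∀ G → Any (G ≅_) (graphsOfSize (size G))
graphsOfSize-complete G =
  Any.map⁺ (Any.map (λ { refl → ≅-fromMatrix }) (∈-vectors (∈-vectors ∈-bools) (adjacencyMatrix G)))
  where
    ≅-fromMatrix : G ≅ ⟨ size G , fromMatrix (adjacencyMatrix G) ⟩
    ≅-fromMatrix = id , id , (λ _ → refl) , (λ _ → refl) , fromMatrix-adjacencyMatrix G

graphsUpTo : ℕ → List Graph
graphsUpTo N = concatMap graphsOfSize (upTo (suc N))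

graphsUpTo-complete : ∀ {N} G → size G ≤ N → Any (G ≅_) (graphsUpTo N)
graphsUpTo-complete G G≤N = Any.concatMap⁺ graphsOfSize (Any.applyUpTo⁺ id (graphsOfSize-complete G) (s≤s G≤N))

HasFiniteForbidden⇒bounded : ∀ {𝒞} → HasFiniteForbidden 𝒞 → Σ ℕ λ m → ∀ F → Forbidden 𝒞 F → size F ≤ m
HasFiniteForbidden⇒bounded (L , covers) =
  max 0 (map size L) , λ F F-forbidden →
    v≤max⁺ 0 (map size L) (inj₂ (Any.map⁺ (Any.map (λ {H} → ≅⇒size≤ {F} {H}) (covers F F-forbidden))))

bounded⇒HasFiniteForbidden : ∀ {𝒞 m} → (∀ F → Forbidden 𝒞 F → size F ≤ m) → HasFiniteForbidden 𝒞
bounded⇒HasFiniteForbidden {m = m} bounded =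
  graphsUpTo m , λ F F-forbidden → graphsUpTo-complete F (bounded F F-forbidden)

corollary2p8 : (𝒢 : GraphClass) → Hereditary 𝒢 → (p : ℕ) →
    HasFiniteForbidden 𝒢 → HasFiniteForbidden (EdgeAdd p 𝒢)
corollary2p8 𝒢 her p finite =
  let k , forbidden-size≤k = HasFiniteForbidden⇒bounded finite
      bad-set : ∀ G → ¬ 𝒢 G → ¬ ¬ BadSet 𝒢 k G
      bad-set = forbidden-size≤⇒bad-set her forbidden-size≤k
  in bounded⇒HasFiniteForbidden (bad-set⇒forbidden-size≤ (EdgeAdd-bad-set her bad-set p))
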